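{- Let $m>0$. Let $2\le a\le b\le c$ and $2\le a'\le b'\le c'$ be integers with $c\ge c'$ such that $(F(a),F(b),F(c))$ and $(F(a'),F(b'),F(c'))$ are both minimal Markoff $m$-triples (for the same $m$). If $a\ge 4$ and $c\ge 9$, then $c'=c$ or $c'=c-1$.
   Context: $F(n)$ denotes the $n$-th Fibonacci number, $F(0)=0$, $F(1)=1$, $F(n+1)=F(n)+F(n-1)$. A Markoff $m$-triple is a triple $(x,y,z)$ of positive integers with $x\le y\le z$ satisfying $x^2+y^2+z^2=3xyz+m$; it is minimal if $z\ge 3xy$. -}

module Defs where

open import Data.Nat using (ℕ; zero; suc; _+_; _*_; _≤_; _<_)
open import Data.Product using (_×_)

F : ℕ → ℕ
F zero = 0
F (suc zero) = 1
F (suc (suc n)) = F (suc n) + F n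

MarkoffTriple : ℕ → ℕ → ℕ → ℕ → Set
MarkoffTriple m x y z =
  (0 < x) × (x ≤ y) × (y ≤ z) × (x * x + y * y + z * z ≡ 3 * x * y * z + m)
  where open import Relation.Binary.PropositionalEquality using (_≡_)

MinimalMarkoffTriple : ℕ → ℕ → ℕ → ℕ → Set
MinimalMarkoffTriple m x y z = MarkoffTriple m x y z × (3 * x * y ≤ z)

{-# OPTIONS --safe #-}
-- For a ≥ 4 the Fibonacci numbers grow at ratio at least 8/5, so F(a+b) < 3 F(a) F(b) ≤ F(c) forces
-- c ≥ a + b + 1, whence 3 F(a) F(b) ≤ (17/20) F(c) and the Markoff equation gives 3 F(c)² ≤ 20 m.
-- Any Markoff m-triple has m ≤ z², so 3 F(c)² ≤ 20 F(c′)²; since F(c) ≥ (13/5) F(c − 2) and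
-- 3 · 13² > 20 · 5², this rules out c′ ≤ c − 2.
module Submission where

open import Defs
open import Data.Nat
  using (ℕ; _≤_; _<_; _∸_; zero; suc; _+_; _*_; z≤n; s≤s; z<s; _≤′_; ≤′-refl; ≤′-step; NonZero; >-nonZero)
open import Data.Nat.Properties
open import Data.Nat.Tactic.RingSolver using (solve-∀; solve)
open import Data.List using (_∷_; [])
open import Data.Product using (_×_; _,_; proj₁)
open import Relation.Nullary using (¬_)
open import Data.Sum using (_⊎_; inj₁; inj₂)
open import Relation.Binary.PropositionalEquality
  using (_≡_; refl; sym; trans; cong; subst₂; module ≡-Reasoning)

-- (8/5)² + 1 ≥ 60/17.
ratio-product : ∀ {x X y Y} → 8 * x ≤ 5 * X → 8 * y ≤ 5 * Y →
                20 * (3 * x * y) ≤ 17 * (X * Y + x * y)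
ratio-product {x} {X} {y} {Y} 8x≤5X 8y≤5Y = *-cancelˡ-≤ 25 (begin
  25 * (20 * (3 * x * y))                     ≡⟨ solve (x ∷ y ∷ []) ⟩
  17 * ((8 * x) * (8 * y)) + 412 * (x * y)    ≤⟨ +-mono-≤ (*-monoʳ-≤ 17 (*-mono-≤ 8x≤5X 8y≤5Y))
                                                          (*-monoˡ-≤ (x * y) (m≤m+n 412 13)) ⟩
  17 * ((5 * X) * (5 * Y)) + 425 * (x * y)    ≡⟨ solve (x ∷ X ∷ y ∷ Y ∷ []) ⟩
  25 * (17 * (X * Y + x * y))                 ∎)
  where open ≤-Reasoning

square-gap : ∀ {x y} → 0 < x → 13 * x ≤ 5 * y → 20 * (x * x) < 3 * (y * y)
square-gap {x} {y} 0<x 13x≤5y = *-cancelˡ-< 25 _ _ (begin-strict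
  25 * (20 * (x * x))         ≡⟨ solve (x ∷ []) ⟩
  500 * (x * x)               <⟨ *-monoˡ-< (x * x) (m<m+n 500 {7} z<s) ⟩
  507 * (x * x)               ≡⟨ solve (x ∷ []) ⟩
  3 * ((13 * x) * (13 * x))   ≤⟨ *-monoʳ-≤ 3 (*-mono-≤ 13x≤5y 13x≤5y) ⟩
  3 * ((5 * y) * (5 * y))     ≡⟨ solve (y ∷ []) ⟩
  25 * (3 * (y * y))          ∎)
  where
  open ≤-Reasoning
  instance
    x≢0 : NonZero x
    x≢0 = >-nonZero 0<x
    x*x≢0 : NonZero (x * x)
    x*x≢0 = m*n≢0 x x

F-+ : ∀ m n → F (suc m + n) ≡ F (suc m) * F (suc n) + F m * F n
F-+ zero    n = sym (trans (+-identityʳ _) (*-identityˡ _))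
F-+ (suc m) n = begin
  F (suc (suc m) + n)                              ≡⟨ cong F (sym (+-suc (suc m) n)) ⟩
  F (suc m + suc n)                                ≡⟨ F-+ m (suc n) ⟩
  F (suc m) * F (suc (suc n)) + F m * F (suc n)    ≡⟨ regroup (F (suc m)) (F m) (F (suc n)) (F n) ⟩
  F (suc (suc m)) * F (suc n) + F (suc m) * F n    ∎
  where
  open ≡-Reasoning
  regroup : ∀ x x₀ y y₀ → x * (y + y₀) + x₀ * y ≡ (x + x₀) * y + x * y₀
  regroup = solve-∀

F-≤-suc : ∀ n → F n ≤ F (suc n)
F-≤-suc zero    = z≤n
F-≤-suc (suc n) = m≤m+n (F (suc n)) (F n)

F-mono-≤ : ∀ {m n} → m ≤ n → F m ≤ F n
F-mono-≤ m≤n = go (≤⇒≤′ m≤n)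
  where
  go : ∀ {m n} → m ≤′ n → F m ≤ F n
  go ≤′-refl              = ≤-refl
  go (≤′-step {n} m≤′n) = ≤-trans (go m≤′n) (F-≤-suc n)

F-cancel-< : ∀ {m n} → F m < F n → m < n
F-cancel-< Fm<Fn = ≰⇒> (λ n≤m → <⇒≱ Fm<Fn (F-mono-≤ n≤m))

F-pos : ∀ {n} → 0 < n → 0 < F n
F-pos = F-mono-≤

F-<-suc : ∀ {n} → 2 ≤ n → F n < F (suc n)
F-<-suc {suc n} (s≤s 1≤n) = m<m+n (F (suc n)) (F-pos 1≤n)

-- 8/5 ≤ F 5 / F 4 = 5/3, and F (n + 2) / F (n + 1) is a mediant of the two preceding ratios.
F-ratio-pair : ∀ k → 8 * F (4 + k) ≤ 5 * F (5 + k) × 8 * F (5 + k) ≤ 5 * F (6 + k)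
F-ratio-pair zero    = n≤1+n 24 , ≤-refl
F-ratio-pair (suc k) with F-ratio-pair k
... | lo , hi = hi , subst₂ _≤_ (sym (*-distribˡ-+ 8 (F (5 + k)) (F (4 + k))))
                                (sym (*-distribˡ-+ 5 (F (6 + k)) (F (5 + k))))
                                (+-mono-≤ hi lo)

F-ratio : ∀ {n} → 4 ≤ n → 8 * F n ≤ 5 * F (suc n)
F-ratio {suc (suc (suc (suc k)))} (s≤s (s≤s (s≤s (s≤s _)))) = proj₁ (F-ratio-pair k)

F-ratio₂ : ∀ {n} → 4 ≤ n → 13 * F n ≤ 5 * F (2 + n)
F-ratio₂ {n} 4≤n = begin
  13 * F n                   ≡⟨ *-distribʳ-+ (F n) 8 5 ⟩
  8 * F n + 5 * F n          ≤⟨ +-monoˡ-≤ (5 * F n) (F-ratio 4≤n) ⟩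
  5 * F (1 + n) + 5 * F n    ≡⟨ *-distribˡ-+ 5 (F (1 + n)) (F n) ⟨
  5 * F (2 + n)              ∎
  where open ≤-Reasoning

F[a+b]<3FaFb : ∀ {a b} → 0 < a → 3 ≤ b → F (a + b) < 3 * F a * F b
F[a+b]<3FaFb {suc i} {suc j} 0<a (s≤s 2≤j) = begin-strict
  F (suc i + suc j)                  ≡⟨ F-+ i (suc j) ⟩
  A * (B + F j) + F i * B            <⟨ +-mono-<-≤ (*-monoʳ-< A (+-monoʳ-< B (F-<-suc 2≤j)))
                                                    (*-monoˡ-≤ B (F-≤-suc i)) ⟩
  A * (B + B) + A * B                ≡⟨ triple A B ⟩
  3 * A * B                          ∎
  where
  open ≤-Reasoning
  A = F (suc i)
  B = F (suc j)
  instance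
    A≢0 : NonZero A
    A≢0 = >-nonZero (F-pos 0<a)
  triple : ∀ x y → x * (y + y) + x * y ≡ 3 * x * y
  triple = solve-∀

F-product-bound : ∀ {a b} → 4 ≤ a → 4 ≤ b → 20 * (3 * F a * F b) ≤ 17 * F (suc (a + b))
F-product-bound {a} {b} 4≤a 4≤b = begin
  20 * (3 * F a * F b)                       ≤⟨ ratio-product {F a} {F (suc a)} {F b} {F (suc b)}
                                                              (F-ratio 4≤a) (F-ratio 4≤b) ⟩
  17 * (F (suc a) * F (suc b) + F a * F b)   ≡⟨ cong (17 *_) (F-+ a b) ⟨
  17 * F (suc (a + b))                       ∎
  where open ≤-Reasoning

F-square-gap : ∀ {i j} → 6 ≤ j → 2 + i ≤ j → 20 * (F i * F i) < 3 * (F j * F j)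
F-square-gap {i} {suc (suc n)} (s≤s (s≤s 4≤n)) (s≤s (s≤s i≤n)) = begin-strict
  20 * (F i * F i)              ≤⟨ *-monoʳ-≤ 20 (*-mono-≤ (F-mono-≤ i≤n) (F-mono-≤ i≤n)) ⟩
  20 * (F n * F n)              <⟨ square-gap {F n} {F (2 + n)} (F-pos (≤-trans (m≤m+n 1 3) 4≤n))
                                                               (F-ratio₂ 4≤n) ⟩
  3 * (F (2 + n) * F (2 + n))   ∎
  where open ≤-Reasoning

markoff-m≤z² : ∀ {m x y z} → MarkoffTriple m x y z → m ≤ z * z
markoff-m≤z² {m} {x} {y} {z} (0<x , x≤y , y≤z , eq) =
  +-cancelˡ-≤ (3 * x * y * z) m (z * z) (begin
    3 * x * y * z + m            ≡⟨ eq ⟨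
    x * x + y * y + z * z        ≤⟨ +-monoˡ-≤ (z * z) x²+y²≤3xyz ⟩
    3 * x * y * z + z * z        ∎)
  where
  open ≤-Reasoning
  instance
    x≢0 : NonZero x
    x≢0 = >-nonZero 0<x
  x²+y²≤3xyz : x * x + y * y ≤ 3 * x * y * z
  x²+y²≤3xyz = begin
    x * x + y * y                            ≤⟨ +-mono-≤ (*-mono-≤ x≤y (≤-trans x≤y y≤z))
                                                          (*-monoʳ-≤ y y≤z) ⟩
    y * z + y * z                            ≤⟨ +-mono-≤ (m≤n*m (y * z) x) (m≤n*m (y * z) x) ⟩
    x * (y * z) + x * (y * z)                ≤⟨ m≤m+n _ (x * (y * z)) ⟩
    x * (y * z) + x * (y * z) + x * (y * z)  ≡⟨ solve (x ∷ y ∷ z ∷ []) ⟩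
    3 * x * y * z                            ∎

markoff-3z²≤20m : ∀ {m x y z} → MarkoffTriple m x y z → 20 * (3 * x * y) ≤ 17 * z →
                  3 * (z * z) ≤ 20 * m
markoff-3z²≤20m {m} {x} {y} {z} (_ , _ , _ , eq) 20·3xy≤17z =
  +-cancelˡ-≤ (17 * (z * z)) (3 * (z * z)) (20 * m) (begin
    17 * (z * z) + 3 * (z * z)     ≡⟨ solve (z ∷ []) ⟩
    20 * (z * z)                   ≤⟨ *-monoʳ-≤ 20 (m≤n+m (z * z) (x * x + y * y)) ⟩
    20 * (x * x + y * y + z * z)   ≡⟨ cong (20 *_) eq ⟩
    20 * (3 * x * y * z + m)       ≡⟨ solve (m ∷ x ∷ y ∷ z ∷ []) ⟩
    20 * (3 * x * y) * z + 20 * m  ≤⟨ +-monoˡ-≤ (20 * m) (*-monoˡ-≤ z 20·3xy≤17z) ⟩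
    17 * z * z + 20 * m            ≡⟨ cong (_+ 20 * m) (*-assoc 17 z z) ⟩
    17 * (z * z) + 20 * m          ∎)
  where open ≤-Reasoning

m≤n≤1+m⇒m≡n∨m≡n∸1 : ∀ {m n} → m ≤ n → n ≤ suc m → m ≡ n ⊎ m ≡ n ∸ 1
m≤n≤1+m⇒m≡n∨m≡n∸1 m≤n n≤1+m with m≤n⇒m<n∨m≡n m≤n
... | inj₁ m<n = inj₂ (cong (_∸ 1) (≤-antisym m<n n≤1+m))
... | inj₂ m≡n = inj₁ m≡n

lemma4p9 : (m a b c a′ b′ c′ : ℕ) → 0 < m →
    2 ≤ a → a ≤ b → b ≤ c → 2 ≤ a′ → a′ ≤ b′ → b′ ≤ c′ → c′ ≤ c →
    MinimalMarkoffTriple m (F a) (F b) (F c) →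
    MinimalMarkoffTriple m (F a′) (F b′) (F c′) →
    4 ≤ a → 9 ≤ c →
    c′ ≡ c ⊎ c′ ≡ c ∸ 1
lemma4p9 m a b c a′ b′ c′ _ _ a≤b _ _ _ _ c′≤c (markoff , minimal) (markoff′ , _) 4≤a 9≤c =
  m≤n≤1+m⇒m≡n∨m≡n∸1 c′≤c (≮⇒≥ no-gap)
  where
  open ≤-Reasoning
  4≤b : 4 ≤ b
  4≤b = ≤-trans 4≤a a≤b
  a+b<c : a + b < c
  a+b<c = F-cancel-< (<-≤-trans (F[a+b]<3FaFb (≤-trans (m≤m+n 1 3) 4≤a) (≤-trans (m≤m+n 3 1) 4≤b))
                                minimal)
  3Fc²≤20m : 3 * (F c * F c) ≤ 20 * m
  3Fc²≤20m = markoff-3z²≤20m markoff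
    (≤-trans (F-product-bound 4≤a 4≤b) (*-monoʳ-≤ 17 (F-mono-≤ a+b<c)))
  no-gap : ¬ (suc c′ < c)
  no-gap 2+c′≤c = <-irrefl refl (begin-strict
    3 * (F c * F c)      ≤⟨ 3Fc²≤20m ⟩
    20 * m               ≤⟨ *-monoʳ-≤ 20 (markoff-m≤z² markoff′) ⟩
    20 * (F c′ * F c′)   <⟨ F-square-gap (≤-trans (m≤m+n 6 3) 9≤c) 2+c′≤c ⟩
    3 * (F c * F c)      ∎)
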